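{- Let $n\ge 3$ and $D_{2n}=\langle r,s\mid r^n=e,\ s^2=e,\ srs=r^{ -1}\rangle$, with rotations $R=\{r^j:j\in\mathbb Z_n\}$ and reflections $M=\{sr^j:j\in\mathbb Z_n\}$. For $X\subseteq D_{2n}$ write $X_R=X\cap R$ and $X_M=X\cap M$. Let $U\subseteq D_{2n}\setminus\{e\}$ be symmetric and suppose $A(D_{2n};U)=A(D_{2n};S)A(D_{2n};T)$ for some symmetric $S,T\subseteq D_{2n}\setminus\{e\}$. Then \[ U\cap R=(S_RT_R)\sqcup(S_MT_M),\qquad U\cap M=(S_RT_M)\sqcup(S_MT_R), \] where $\sqcup$ denotes disjoint union.
   Context: A subset $X$ is symmetric if $X^{ -1}=X$. Fix an enumeration $D_{2n}=\{g_1,\dots,g_{2n}\}$; $A(D_{2n};X)$ is the matrix with $(i,j)$ entry $1$ if $g_i^{ -1}g_j\in X$ and $0$ otherwise. $XY=\{xy:x\in X,y\in Y\}$. -}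

module Defs where

open import Data.Nat using (ℕ; zero; suc; _+_; _*_; _∸_; NonZero)
open import Data.Nat.DivMod using (_%_; m%n<n)
open import Data.Bool using (Bool; true; false; not; _∧_; if_then_else_)
open import Data.Fin using (Fin; toℕ; fromℕ<)
import Data.Fin as F
open import Data.Product using (_×_; _,_; ∃-syntax)
open import Relation.Binary.PropositionalEquality using (_≡_)

module _ (n : ℕ) .{{_ : NonZero n}} where

  modN : ℕ → Fin n
  modN m = fromℕ< (m%n<n m n)

  _⊕_ : Fin n → Fin n → Fin n
  a ⊕ b = modN (toℕ a + toℕ b)

  ⊖_ : Fin n → Fin n
  ⊖ a = modN (n ∸ toℕ a)

  -- Elements of D_{2n}: (false , j) is r^j, (true , j) is s r^j.
  D : Set
  D = Bool × Fin n

  e : D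
  e = false , modN 0

  -- r^a r^b = r^(a+b), r^a s r^b = s r^(b-a),
  -- s r^a r^b = s r^(a+b), s r^a s r^b = r^(b-a).
  mul : D → D → D
  mul (false , a) (false , b) = false , (a ⊕ b)
  mul (false , a) (true  , b) = true  , (b ⊕ (⊖ a))
  mul (true  , a) (false , b) = true  , (a ⊕ b)
  mul (true  , a) (true  , b) = false , (b ⊕ (⊖ a))

  inv : D → D
  inv (false , a) = false , (⊖ a)
  inv (true  , a) = true  , a

  isRot : D → Bool
  isRot (b , _) = not b

  isRefl : D → Bool
  isRefl (b , _) = b

  Subset : Set
  Subset = D → Bool

  _∩R : Subset → Subset
  (X ∩R) x = X x ∧ isRot x

  _∩M : Subset → Subset
  (X ∩M) x = X x ∧ isRefl x

  Symmetric : Subset → Set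
  Symmetric X = ∀ x → X (inv x) ≡ X x

  AvoidsE : Subset → Set
  AvoidsE X = X e ≡ false

  InProd : Subset → Subset → D → Set
  InProd X Y g = ∃[ x ] ∃[ y ] (X x ≡ true × Y y ≡ true × mul x y ≡ g)

  Matrix : Set
  Matrix = D → D → ℕ

  adj : Subset → Matrix
  adj X g h = if X (mul (inv g) h) then 1 else 0

  sumFin : ∀ {m} → (Fin m → ℕ) → ℕ
  sumFin {zero} f = 0
  sumFin {suc m} f = f F.zero + sumFin (λ i → f (F.suc i))

  sumD : (D → ℕ) → ℕ
  sumD f = sumFin (λ j → f (false , j)) + sumFin (λ j → f (true , j))

  _·_ : Matrix → Matrix → Matrix
  (P · Q) g h = sumD (λ k → P g k * Q k h)

{-# OPTIONS --safe #-}

-- Read in the row of e, the identity A(U) = A(S)A(T) says that [x ∈ U] is the number of pairs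
-- (s , t) ∈ S × T with s t = x. Hence U = ST and every element of U factors uniquely. Since s t
-- is a rotation exactly when s and t are of the same kind, sorting the factorisations of g by the
-- kind of s gives both decompositions, and uniqueness of s makes each union disjoint.

module Submission where

open import Defs
open import Algebra.Bundles using (AbelianGroup)
open import Algebra.Consequences.Propositional using (comm∧idˡ⇒id; comm∧invˡ⇒inv)
open import Algebra.Structures using (IsAbelianGroup)
import Algebra.Properties.AbelianGroup as AbelianGroupProperties
open import Data.Bool using (Bool; true; false; not; _∧_; _xor_; if_then_else_)
open import Data.Bool.Properties using (not-involutive; ∧-identityʳ; ∧-zeroʳ) renaming (_≟_ to _≟ᴮ_)
open import Data.Fin using (Fin; toℕ; zero; suc)
open import Data.Fin.Properties using (toℕ-injective; toℕ-fromℕ<; toℕ<n) renaming (_≟_ to _≟ᶠ_)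
import Data.Nat as ℕ
open import Data.Nat using (ℕ; NonZero; _+_; _*_; _∸_; _%_; _≤_; _<_; z≤n; z<s)
open import Data.Nat.DivMod using (m%n<n; %-distribˡ-+; m%n%n≡m%n; m<n⇒m%n≡m; [m+n]%n≡m%n)
open import Data.Nat.Properties
  using (+-comm; +-assoc; m∸n+n≡m; <⇒≤; ≤-refl; ≤-trans; ≤-reflexive; m≤m+n; m≤n+m; +-mono-≤; +-monoʳ-≤; 1+n≰n; module ≤-Reasoning)
open import Data.Product using (_×_; _,_; ∃-syntax)
import Data.Product as Product
open import Data.Product.Properties using (≡-dec)
open import Data.Sum using (_⊎_; inj₁; inj₂; [_,_])
open import Function using (_∘_; id)
open import Function.Bundles using (_⇔_; mk⇔; Equivalence)
open import Relation.Binary.Definitions using (DecidableEquality)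
open import Relation.Binary.PropositionalEquality
  using (_≡_; _≢_; refl; sym; trans; cong; cong₂; subst; isEquivalence; module ≡-Reasoning)
open import Relation.Nullary using (¬_; yes; no; contradiction)

module ℤ/nℤ (n : ℕ) .{{_ : NonZero n}} where

  0ₙ : Fin n
  0ₙ = modN n 0

  private
    _+ₙ_ : Fin n → Fin n → Fin n
    _+ₙ_ = _⊕_ n

    -ₙ_ : Fin n → Fin n
    -ₙ_ = ⊖_ n

  toℕ-modN : ∀ m → toℕ (modN n m) ≡ m % n
  toℕ-modN m = toℕ-fromℕ< (m%n<n m n)

  [m%n+k]%n≡[m+k]%n : ∀ m k → (m % n + k) % n ≡ (m + k) % n
  [m%n+k]%n≡[m+k]%n m k = begin
    (m % n + k) % n           ≡⟨ %-distribˡ-+ (m % n) k n ⟩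
    (m % n % n + k % n) % n   ≡⟨ cong (λ r → (r + k % n) % n) (m%n%n≡m%n m n) ⟩
    (m % n + k % n) % n       ≡⟨ %-distribˡ-+ m k n ⟨
    (m + k) % n               ∎
    where open ≡-Reasoning

  toℕ-⊕ : ∀ a b → toℕ (a +ₙ b) ≡ (toℕ a + toℕ b) % n
  toℕ-⊕ a b = toℕ-modN (toℕ a + toℕ b)

  toℕ-[⊕]⊕ : ∀ a b c → toℕ ((a +ₙ b) +ₙ c) ≡ (toℕ a + toℕ b + toℕ c) % n
  toℕ-[⊕]⊕ a b c = begin
    toℕ ((a +ₙ b) +ₙ c)                ≡⟨ toℕ-⊕ (a +ₙ b) c ⟩
    (toℕ (a +ₙ b) + toℕ c) % n         ≡⟨ cong (λ r → (r + toℕ c) % n) (toℕ-⊕ a b) ⟩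
    ((toℕ a + toℕ b) % n + toℕ c) % n  ≡⟨ [m%n+k]%n≡[m+k]%n (toℕ a + toℕ b) (toℕ c) ⟩
    (toℕ a + toℕ b + toℕ c) % n        ∎
    where open ≡-Reasoning

  ⊕-comm : ∀ a b → a +ₙ b ≡ b +ₙ a
  ⊕-comm a b = cong (modN n) (+-comm (toℕ a) (toℕ b))

  ⊕-assoc : ∀ a b c → (a +ₙ b) +ₙ c ≡ a +ₙ (b +ₙ c)
  ⊕-assoc a b c = toℕ-injective (begin
    toℕ ((a +ₙ b) +ₙ c)            ≡⟨ toℕ-[⊕]⊕ a b c ⟩
    (toℕ a + toℕ b + toℕ c) % n    ≡⟨ cong (_% n) (+-assoc (toℕ a) (toℕ b) (toℕ c)) ⟩
    (toℕ a + (toℕ b + toℕ c)) % n  ≡⟨ cong (_% n) (+-comm (toℕ a) (toℕ b + toℕ c)) ⟩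
    (toℕ b + toℕ c + toℕ a) % n    ≡⟨ toℕ-[⊕]⊕ b c a ⟨
    toℕ ((b +ₙ c) +ₙ a)            ≡⟨ cong toℕ (⊕-comm (b +ₙ c) a) ⟩
    toℕ (a +ₙ (b +ₙ c))            ∎)
    where open ≡-Reasoning

  ⊕-identityˡ : ∀ a → 0ₙ +ₙ a ≡ a
  ⊕-identityˡ a = toℕ-injective (begin
    toℕ (0ₙ +ₙ a)           ≡⟨ toℕ-⊕ 0ₙ a ⟩
    (toℕ 0ₙ + toℕ a) % n    ≡⟨ cong (λ r → (r + toℕ a) % n) (toℕ-modN 0) ⟩
    (0 % n + toℕ a) % n     ≡⟨ [m%n+k]%n≡[m+k]%n 0 (toℕ a) ⟩
    toℕ a % n               ≡⟨ m<n⇒m%n≡m (toℕ<n a) ⟩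
    toℕ a                   ∎)
    where open ≡-Reasoning

  ⊖-inverseˡ : ∀ a → (-ₙ a) +ₙ a ≡ 0ₙ
  ⊖-inverseˡ a = toℕ-injective (begin
    toℕ ((-ₙ a) +ₙ a)                  ≡⟨ toℕ-⊕ (-ₙ a) a ⟩
    (toℕ (-ₙ a) + toℕ a) % n           ≡⟨ cong (λ r → (r + toℕ a) % n) (toℕ-modN (n ∸ toℕ a)) ⟩
    ((n ∸ toℕ a) % n + toℕ a) % n      ≡⟨ [m%n+k]%n≡[m+k]%n (n ∸ toℕ a) (toℕ a) ⟩
    (n ∸ toℕ a + toℕ a) % n            ≡⟨ cong (_% n) (m∸n+n≡m (<⇒≤ (toℕ<n a))) ⟩
    n % n                              ≡⟨ [m+n]%n≡m%n 0 n ⟩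
    0 % n                              ≡⟨ toℕ-modN 0 ⟨
    toℕ 0ₙ                             ∎)
    where open ≡-Reasoning

  ⊕-⊖-isAbelianGroup : IsAbelianGroup _≡_ _+ₙ_ 0ₙ -ₙ_
  ⊕-⊖-isAbelianGroup = record
    { isGroup = record
      { isMonoid = record
        { isSemigroup = record
          { isMagma = record { isEquivalence = isEquivalence ; ∙-cong = cong₂ _+ₙ_ }
          ; assoc = ⊕-assoc
          }
        ; identity = comm∧idˡ⇒id ⊕-comm ⊕-identityˡ
        }
      ; inverse = comm∧invˡ⇒inv ⊕-comm ⊖-inverseˡ
      ; ⁻¹-cong = cong -ₙ_
      }
    ; comm = ⊕-comm
    }

  ⊕-⊖-abelianGroup : AbelianGroup _ _
  ⊕-⊖-abelianGroup = record { isAbelianGroup = ⊕-⊖-isAbelianGroup }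

module Dihedral (n : ℕ) .{{_ : NonZero n}} where

  private
    module ℤₙ = AbelianGroupProperties (ℤ/nℤ.⊕-⊖-abelianGroup n)
    open AbelianGroup (ℤ/nℤ.⊕-⊖-abelianGroup n) using (assoc; identityˡ; identityʳ)

  infixl 7 _∙_
  _∙_ : D n → D n → D n
  _∙_ = mul n

  infix 8 _⁻¹
  _⁻¹ : D n → D n
  _⁻¹ = inv n

  _≟_ : DecidableEquality (D n)
  _≟_ = ≡-dec _≟ᴮ_ _≟ᶠ_

  isRefl-∙ : ∀ x y → isRefl n (x ∙ y) ≡ isRefl n x xor isRefl n y
  isRefl-∙ (false , _) (false , _) = refl
  isRefl-∙ (false , _) (true  , _) = refl
  isRefl-∙ (true  , _) (false , _) = refl
  isRefl-∙ (true  , _) (true  , _) = refl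

  ε⁻¹≡ε : e n ⁻¹ ≡ e n
  ε⁻¹≡ε = cong (false ,_) ℤₙ.ε⁻¹≈ε

  ∙-identityˡ : ∀ x → e n ∙ x ≡ x
  ∙-identityˡ (false , a) = cong (false ,_) (identityˡ a)
  ∙-identityˡ (true  , a) = cong (true ,_) (trans (cong (_⊕_ n a) ℤₙ.ε⁻¹≈ε) (identityʳ a))

  ⁻¹-involutive : ∀ x → x ⁻¹ ⁻¹ ≡ x
  ⁻¹-involutive (false , a) = cong (false ,_) (ℤₙ.⁻¹-involutive a)
  ⁻¹-involutive (true  , a) = refl

  x⁻¹[xy]≡y : ∀ x y → x ⁻¹ ∙ (x ∙ y) ≡ y
  x⁻¹[xy]≡y (false , a) (false , b) = cong (false ,_) (ℤₙ.\\-leftDividesʳ a b)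
  x⁻¹[xy]≡y (false , a) (true  , b) = cong (true ,_) (ℤₙ.//-rightDividesʳ (⊖_ n a) b)
  x⁻¹[xy]≡y (true  , a) (false , b) = cong (false ,_) (ℤₙ.xyx⁻¹≈y a b)
  x⁻¹[xy]≡y (true  , a) (true  , b) = cong (true ,_) (trans (sym (assoc a b _)) (ℤₙ.xyx⁻¹≈y a b))

  x[x⁻¹y]≡y : ∀ x y → x ∙ (x ⁻¹ ∙ y) ≡ y
  x[x⁻¹y]≡y x y = subst (λ z → z ∙ (x ⁻¹ ∙ y) ≡ y) (⁻¹-involutive x) (x⁻¹[xy]≡y (x ⁻¹) y)

0<m+n⇒0<m⊎0<n : ∀ m n → 0 < m + n → 0 < m ⊎ 0 < n
0<m+n⇒0<m⊎0<n (ℕ.suc _) _ _   = inj₁ z<s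
0<m+n⇒0<m⊎0<n 0         _ 0<n = inj₂ 0<n

module Sums (n : ℕ) .{{_ : NonZero n}} where

  sumFin-cong : ∀ {m} {f g : Fin m → ℕ} → (∀ i → f i ≡ g i) → sumFin n f ≡ sumFin n g
  sumFin-cong {0}       f≗g = refl
  sumFin-cong {ℕ.suc m} f≗g = cong₂ _+_ (f≗g zero) (sumFin-cong (f≗g ∘ suc))

  sumFin-≥ : ∀ {m} (f : Fin m → ℕ) i → f i ≤ sumFin n f
  sumFin-≥ f zero    = m≤m+n _ _
  sumFin-≥ f (suc i) = ≤-trans (sumFin-≥ (f ∘ suc) i) (m≤n+m _ _)

  sumFin-≥-pair : ∀ {m} (f : Fin m → ℕ) i j → i ≢ j → f i + f j ≤ sumFin n f
  sumFin-≥-pair f zero    zero    i≢j = contradiction refl i≢j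
  sumFin-≥-pair f zero    (suc j) _   = +-monoʳ-≤ (f zero) (sumFin-≥ (f ∘ suc) j)
  sumFin-≥-pair f (suc i) zero    _   =
    ≤-trans (≤-reflexive (+-comm (f (suc i)) (f zero))) (+-monoʳ-≤ (f zero) (sumFin-≥ (f ∘ suc) i))
  sumFin-≥-pair f (suc i) (suc j) i≢j =
    ≤-trans (sumFin-≥-pair (f ∘ suc) i j (i≢j ∘ cong suc)) (m≤n+m _ _)

  sumFin-positive : ∀ {m} (f : Fin m → ℕ) → 0 < sumFin n f → ∃[ i ] 0 < f i
  sumFin-positive {0}       f ()
  sumFin-positive {ℕ.suc m} f 0<Σ =
    [ (λ 0<f₀ → zero , 0<f₀) , Product.map suc id ∘ sumFin-positive (f ∘ suc) ]
      (0<m+n⇒0<m⊎0<n (f zero) _ 0<Σ)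

  sumD-cong : ∀ {f g : D n → ℕ} → (∀ x → f x ≡ g x) → sumD n f ≡ sumD n g
  sumD-cong f≗g = cong₂ _+_ (sumFin-cong (f≗g ∘ (false ,_))) (sumFin-cong (f≗g ∘ (true ,_)))

  sumD-≥ : ∀ (f : D n → ℕ) x → f x ≤ sumD n f
  sumD-≥ f (false , a) = ≤-trans (sumFin-≥ (f ∘ (false ,_)) a) (m≤m+n _ _)
  sumD-≥ f (true  , a) = ≤-trans (sumFin-≥ (f ∘ (true ,_)) a) (m≤n+m _ _)

  sumD-≥-pair : ∀ (f : D n → ℕ) x y → x ≢ y → f x + f y ≤ sumD n f
  sumD-≥-pair f (false , a) (false , b) x≢y =
    ≤-trans (sumFin-≥-pair (f ∘ (false ,_)) a b (x≢y ∘ cong (false ,_))) (m≤m+n _ _)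
  sumD-≥-pair f (false , a) (true , b) _ =
    +-mono-≤ (sumFin-≥ (f ∘ (false ,_)) a) (sumFin-≥ (f ∘ (true ,_)) b)
  sumD-≥-pair f (true , a) (false , b) _ =
    ≤-trans (≤-reflexive (+-comm (f (true , a)) _)) (sumD-≥-pair f (false , b) (true , a) λ ())
  sumD-≥-pair f (true , a) (true , b) x≢y =
    ≤-trans (sumFin-≥-pair (f ∘ (true ,_)) a b (x≢y ∘ cong (true ,_))) (m≤n+m _ _)

  sumD-positive : ∀ (f : D n → ℕ) → 0 < sumD n f → ∃[ x ] 0 < f x
  sumD-positive f 0<Σ =
    [ Product.map (false ,_) id ∘ sumFin-positive (f ∘ (false ,_))
    , Product.map (true ,_) id ∘ sumFin-positive (f ∘ (true ,_)) ]
      (0<m+n⇒0<m⊎0<n _ _ 0<Σ)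

module Kinds (n : ℕ) .{{_ : NonZero n}} where

  open Dihedral n

  infixl 6 _∩[_]
  _∩[_] : Subset n → Bool → Subset n
  X ∩[ false ] = _∩R n X
  X ∩[ true  ] = _∩M n X

  ∩[]-elim : ∀ X p x → (X ∩[ p ]) x ≡ true → X x ≡ true × isRefl n x ≡ p
  ∩[]-elim X false (false , a) x∈X = trans (sym (∧-identityʳ (X (false , a)))) x∈X , refl
  ∩[]-elim X false (true  , a) x∈X = contradiction (trans (sym (∧-zeroʳ (X (true , a)))) x∈X) λ ()
  ∩[]-elim X true  (false , a) x∈X = contradiction (trans (sym (∧-zeroʳ (X (false , a)))) x∈X) λ ()
  ∩[]-elim X true  (true  , a) x∈X = trans (sym (∧-identityʳ (X (true , a)))) x∈X , refl

  ∩[]-intro : ∀ X {p} x → X x ≡ true → isRefl n x ≡ p → (X ∩[ p ]) x ≡ true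
  ∩[]-intro X (false , a) x∈X refl = cong (_∧ true) x∈X
  ∩[]-intro X (true  , a) x∈X refl = cong (_∧ true) x∈X

  InProd-∩[] : ∀ X Y p q {g} → InProd n (X ∩[ p ]) (Y ∩[ q ]) g → InProd n X Y g × isRefl n g ≡ p xor q
  InProd-∩[] X Y p q (x , y , x∈Xp , y∈Yq , refl) with ∩[]-elim X p x x∈Xp | ∩[]-elim Y q y y∈Yq
  ... | x∈X , refl | y∈Y , refl = (x , y , x∈X , y∈Y , refl) , isRefl-∙ x y

  InProd-by-kind : ∀ X Y g c →
    (InProd n X Y g × isRefl n g ≡ c) ⇔
    (InProd n (X ∩[ false ]) (Y ∩[ c ]) g ⊎ InProd n (X ∩[ true ]) (Y ∩[ not c ]) g)
  InProd-by-kind X Y g c = mk⇔ (split g c) join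
    where
    split : ∀ g c → InProd n X Y g × isRefl n g ≡ c →
      InProd n (X ∩[ false ]) (Y ∩[ c ]) g ⊎ InProd n (X ∩[ true ]) (Y ∩[ not c ]) g
    split _ _ ((x@(false , _) , y@(false , _) , x∈X , y∈Y , refl) , refl) =
      inj₁ (x , y , ∩[]-intro X x x∈X refl , ∩[]-intro Y y y∈Y refl , refl)
    split _ _ ((x@(false , _) , y@(true , _) , x∈X , y∈Y , refl) , refl) =
      inj₁ (x , y , ∩[]-intro X x x∈X refl , ∩[]-intro Y y y∈Y refl , refl)
    split _ _ ((x@(true , _) , y@(false , _) , x∈X , y∈Y , refl) , refl) =
      inj₂ (x , y , ∩[]-intro X x x∈X refl , ∩[]-intro Y y y∈Y refl , refl)
    split _ _ ((x@(true , _) , y@(true , _) , x∈X , y∈Y , refl) , refl) =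
      inj₂ (x , y , ∩[]-intro X x x∈X refl , ∩[]-intro Y y y∈Y refl , refl)

    join : InProd n (X ∩[ false ]) (Y ∩[ c ]) g ⊎ InProd n (X ∩[ true ]) (Y ∩[ not c ]) g →
      InProd n X Y g × isRefl n g ≡ c
    join (inj₁ g∈XY) = InProd-∩[] X Y false c g∈XY
    join (inj₂ g∈XY) = Product.map id (λ kind → trans kind (not-involutive c)) (InProd-∩[] X Y true (not c) g∈XY)

𝟙 : Bool → ℕ
𝟙 b = if b then 1 else 0

𝟙-positive : ∀ {b} → 0 < 𝟙 b → b ≡ true
𝟙-positive {true} _ = refl

𝟙≤1 : ∀ b → 𝟙 b ≤ 1
𝟙≤1 true  = ≤-refl
𝟙≤1 false = z≤n

𝟙*𝟙-positive : ∀ b c → 0 < 𝟙 b * 𝟙 c → b ≡ true × c ≡ true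
𝟙*𝟙-positive true true _ = refl , refl

module Factorisation (n : ℕ) .{{_ : NonZero n}} (U S T : Subset n)
  (A[U]≡A[S]A[T] : ∀ g h → adj n U g h ≡ _·_ n (adj n S) (adj n T) g h) where

  open Dihedral n
  open Sums n
  open Kinds n

  factorsVia : D n → D n → ℕ
  factorsVia x s = 𝟙 (S s) * 𝟙 (T (s ⁻¹ ∙ x))

  𝟙U≡#factorisations : ∀ x → 𝟙 (U x) ≡ sumD n (factorsVia x)
  𝟙U≡#factorisations x = begin
    𝟙 (U x)                                         ≡⟨ cong (𝟙 ∘ U) (e⁻¹∙x≡x x) ⟨
    adj n U (e n) x                                 ≡⟨ A[U]≡A[S]A[T] (e n) x ⟩
    sumD n (λ s → adj n S (e n) s * adj n T s x)    ≡⟨ sumD-cong (λ s → cong (λ s′ → 𝟙 (S s′) * adj n T s x) (e⁻¹∙x≡x s)) ⟩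
    sumD n (factorsVia x)                           ∎
    where
    open ≡-Reasoning
    e⁻¹∙x≡x : ∀ x → e n ⁻¹ ∙ x ≡ x
    e⁻¹∙x≡x x = trans (cong (_∙ x) ε⁻¹≡ε) (∙-identityˡ x)

  factorsVia≡1 : ∀ {s t x} → S s ≡ true → T t ≡ true → s ∙ t ≡ x → factorsVia x s ≡ 1
  factorsVia≡1 {s} {t} s∈S t∈T refl rewrite s∈S | x⁻¹[xy]≡y s t | t∈T = refl

  ∈U⇒∈ST : ∀ {x} → U x ≡ true → InProd n S T x
  ∈U⇒∈ST {x} x∈U
    with sumD-positive (factorsVia x) (subst (0 <_) (trans (cong 𝟙 (sym x∈U)) (𝟙U≡#factorisations x)) z<s)
  ... | s , 0<term with 𝟙*𝟙-positive (S s) (T (s ⁻¹ ∙ x)) 0<term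
  ... | s∈S , s⁻¹x∈T = s , s ⁻¹ ∙ x , s∈S , s⁻¹x∈T , x[x⁻¹y]≡y s x

  ∈ST⇒∈U : ∀ {x} → InProd n S T x → U x ≡ true
  ∈ST⇒∈U {x} (s , t , s∈S , t∈T , st≡x) = 𝟙-positive (begin-strict
    0                       <⟨ z<s ⟩
    1                       ≡⟨ factorsVia≡1 s∈S t∈T st≡x ⟨
    factorsVia x s          ≤⟨ sumD-≥ (factorsVia x) s ⟩
    sumD n (factorsVia x)   ≡⟨ 𝟙U≡#factorisations x ⟨
    𝟙 (U x)                 ∎)
    where open ≤-Reasoning

  factorisation-unique : ∀ {s t s′ t′ x} →
    S s ≡ true → T t ≡ true → s ∙ t ≡ x →
    S s′ ≡ true → T t′ ≡ true → s′ ∙ t′ ≡ x → s ≡ s′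
  factorisation-unique {s} {s′ = s′} {x = x} s∈S t∈T st≡x s′∈S t′∈T s′t′≡x with s ≟ s′
  ... | yes s≡s′ = s≡s′
  ... | no  s≢s′ = contradiction (≤-trans 2≤𝟙[Ux] (𝟙≤1 (U x))) 1+n≰n
    where
    open ≤-Reasoning
    2≤𝟙[Ux] : 2 ≤ 𝟙 (U x)
    2≤𝟙[Ux] = begin
      2                                   ≡⟨ cong₂ _+_ (factorsVia≡1 s∈S t∈T st≡x) (factorsVia≡1 s′∈S t′∈T s′t′≡x) ⟨
      factorsVia x s + factorsVia x s′    ≤⟨ sumD-≥-pair (factorsVia x) s s′ s≢s′ ⟩
      sumD n (factorsVia x)               ≡⟨ 𝟙U≡#factorisations x ⟨
      𝟙 (U x)                             ∎

  U∩[]-decomposition : ∀ c g →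
    (U ∩[ c ]) g ≡ true ⇔ (InProd n (S ∩[ false ]) (T ∩[ c ]) g ⊎ InProd n (S ∩[ true ]) (T ∩[ not c ]) g)
  U∩[]-decomposition c g = mk⇔ to from
    where
    open Equivalence (InProd-by-kind S T g c) renaming (to to split; from to join)

    to : (U ∩[ c ]) g ≡ true → InProd n (S ∩[ false ]) (T ∩[ c ]) g ⊎ InProd n (S ∩[ true ]) (T ∩[ not c ]) g
    to g∈Uc with ∩[]-elim U c g g∈Uc
    ... | g∈U , kind = split (∈U⇒∈ST g∈U , kind)

    from : InProd n (S ∩[ false ]) (T ∩[ c ]) g ⊎ InProd n (S ∩[ true ]) (T ∩[ not c ]) g → (U ∩[ c ]) g ≡ true
    from g∈ST with join g∈ST
    ... | g∈ST , kind = ∩[]-intro U g (∈ST⇒∈U g∈ST) kind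

  decomposition-disjoint : ∀ c g →
    ¬ (InProd n (S ∩[ false ]) (T ∩[ c ]) g × InProd n (S ∩[ true ]) (T ∩[ not c ]) g)
  decomposition-disjoint c g ((s , t , s∈S₀ , t∈Tc , st≡g) , (s′ , t′ , s′∈S₁ , t′∈T¬c , s′t′≡g))
    with ∩[]-elim S false s s∈S₀ | ∩[]-elim T c t t∈Tc
       | ∩[]-elim S true s′ s′∈S₁ | ∩[]-elim T (not c) t′ t′∈T¬c
  ... | s∈S , s-kind | t∈T , _ | s′∈S , s′-kind | t′∈T , _
    with factorisation-unique s∈S t∈T st≡g s′∈S t′∈T s′t′≡g
  ... | refl = contradiction (trans (sym s-kind) s′-kind) λ ()

mainTheorem15 : (n : ℕ) .{{_ : NonZero n}} → 3 ≤ n →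
    (U S T : Subset n) →
    Symmetric n U → AvoidsE n U →
    Symmetric n S → AvoidsE n S →
    Symmetric n T → AvoidsE n T →
    (∀ g h → adj n U g h ≡ _·_ n (adj n S) (adj n T) g h) →
    ((∀ g → ((_∩R n U) g ≡ true) ⇔ (InProd n (_∩R n S) (_∩R n T) g ⊎ InProd n (_∩M n S) (_∩M n T) g))
     × (∀ g → ¬ (InProd n (_∩R n S) (_∩R n T) g × InProd n (_∩M n S) (_∩M n T) g)))
    × ((∀ g → ((_∩M n U) g ≡ true) ⇔ (InProd n (_∩R n S) (_∩M n T) g ⊎ InProd n (_∩M n S) (_∩R n T) g))
     × (∀ g → ¬ (InProd n (_∩R n S) (_∩M n T) g × InProd n (_∩M n S) (_∩R n T) g)))
mainTheorem15 n _ U S T _ _ _ _ _ _ A[U]≡A[S]A[T] =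
  (U∩[]-decomposition false , decomposition-disjoint false) , (U∩[]-decomposition true , decomposition-disjoint true)
  where open Factorisation n U S T A[U]≡A[S]A[T]
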